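{- Let $y\in 2\mathbb{N}+1=\{2n+1:n\in\mathbb{N}\}$ and let $S\subset\mathbb{N}$ be a $2$-syndetic set such that $y^2(y^2+2i)\in S$ for each $i\in\{1,-1\}$. Then $S$ contains a set of the form $\{x,xr^2\}$ with $x,r\in\mathbb{N}\setminus\{1\}$ and $x\ge\frac{y^2-1}{4}$.
   Context: $\mathbb{N}=\{1,2,3,\dots\}$. A set $S\subset\mathbb{N}$ is $2$-syndetic if for every $n\in\mathbb{N}$ at least one of $n,n+1$ lies in $S$. -}

module Defs where

open import Data.Nat using (ℕ; suc; _≤_)
open import Data.Sum using (_⊎_)

-- A subset of ℕ = {1,2,3,...} is represented by a predicate on Agda's ℕ;
-- membership of 0 is irrelevant (never used below).
-- S is 2-syndetic: for every n ≥ 1, at least one of n, n+1 lies in S.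
TwoSyndetic : (ℕ → Set) → Set
TwoSyndetic S = ∀ (n : ℕ) → 1 ≤ n → S n ⊎ S (suc n)

module Submission where

-- Write y² = 4k + 1 (possible since y is odd; k = n(n+1) ≥ 2 for y = 2n+1).
-- The hypotheses say that S contains y²·(y²+2) and y²·(y²−2).
--   * If y²+2 ∈ S or y²−2 ∈ S, that number x together with r = y gives
--     the pair {x, x·y²} ⊆ S.
--   * Otherwise 2-syndeticity at y²+2 and at y²−2 puts y²+3 = 4(k+1) and
--     y²−1 = 4k into S; syndeticity at k then puts k or k+1 into S, and
--     with r = 2 this gives the pair {x, 4x} ⊆ S for x ∈ {k, k+1}.

open import Defs
open import Data.Nat using (ℕ; suc; _+_; _*_; _∸_; _^_; _≤_; s≤s; z≤n)
open import Data.Nat.Properties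
  using (≤-refl; ≤-trans; *-comm; *-monoʳ-≤; n≤1+n; m≤m+n; m≤n+m; m≤n*m; m∸n≤m)
open import Data.Product using (∃-syntax; _×_; _,_)
open import Data.Sum using (_⊎_; inj₁; inj₂)
open import Relation.Binary.PropositionalEquality using (_≡_; refl; sym; cong; subst)
open import Data.Nat.Tactic.RingSolver using (solve-∀)

SquareRatioPair : (ℕ → Set) → ℕ → Set
SquareRatioPair S m =
  ∃[ x ] ∃[ r ] (2 ≤ x × 2 ≤ r × S x × S (x * r ^ 2) × m ≤ 4 * x)

ratioPair : ∀ {S : ℕ → Set} {k} x r → 2 ≤ x → 2 ≤ r → k ≤ x →
            S x → S (x * r ^ 2) → SquareRatioPair S (4 * k)
ratioPair x r 2≤x 2≤r k≤x sx sxr² = x , r , 2≤x , 2≤r , sx , sxr² , *-monoʳ-≤ 4 k≤x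

-- Arithmetic of Y = 4k + 1 with k ≥ 1: the neighbours of Y ± 2 that the
-- syndeticity argument reaches are 4k and 4(k+1), and Y − 2 is still ≥ k.

successorBelow : ∀ {Y k} → 1 ≤ k → Y ≡ suc (4 * k) → suc (Y ∸ 2) ≡ 4 * k
successorBelow {k = suc _} _ refl = refl

successorAbove : ∀ {Y k} → Y ≡ suc (4 * k) → suc (Y + 2) ≡ 4 * suc k
successorAbove {k = k} refl = shift k
  where
  shift : ∀ k → suc (suc (4 * k) + 2) ≡ 4 * suc k
  shift = solve-∀

lowerBound : ∀ {Y k} → 1 ≤ k → Y ≡ suc (4 * k) → k ≤ Y ∸ 2
lowerBound {k = suc j} _ refl = ≤-trans (m≤n*m (suc j) 3) (m≤n+m (3 * suc j) j)

fourMultiplesPair : ∀ {S : ℕ → Set} → TwoSyndetic S → ∀ k → 2 ≤ k →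
                    S (4 * k) → S (4 * suc k) → SquareRatioPair S (4 * k)
fourMultiplesPair {S} T k 2≤k s4k s4k+4 with T k (≤-trans (s≤s z≤n) 2≤k)
... | inj₁ sk   = ratioPair k 2 2≤k ≤-refl ≤-refl sk (subst S (*-comm 4 k) s4k)
... | inj₂ sk+1 = ratioPair (suc k) 2 (≤-trans 2≤k (n≤1+n k)) ≤-refl (n≤1+n k) sk+1
                    (subst S (*-comm 4 (suc k)) s4k+4)

nearSquarePair : ∀ {S : ℕ → Set} → TwoSyndetic S → ∀ r k → 2 ≤ r → 2 ≤ k →
                 r ^ 2 ≡ suc (4 * k) →
                 S (r ^ 2 * (r ^ 2 + 2)) → S (r ^ 2 * (r ^ 2 ∸ 2)) →
                 SquareRatioPair S (4 * k)
nearSquarePair {S} T r k 2≤r 2≤k sq s₊ s₋ =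
  cases (T (r ^ 2 + 2) (≤-trans (s≤s z≤n) 2≤Y+2)) (T (r ^ 2 ∸ 2) (≤-trans (s≤s z≤n) 2≤Y∸2))
  where
  1≤k : 1 ≤ k
  1≤k = ≤-trans (s≤s z≤n) 2≤k

  k≤Y∸2 : k ≤ r ^ 2 ∸ 2
  k≤Y∸2 = lowerBound 1≤k sq

  k≤Y+2 : k ≤ r ^ 2 + 2
  k≤Y+2 = ≤-trans k≤Y∸2 (≤-trans (m∸n≤m (r ^ 2) 2) (m≤m+n (r ^ 2) 2))

  2≤Y∸2 : 2 ≤ r ^ 2 ∸ 2
  2≤Y∸2 = ≤-trans 2≤k k≤Y∸2

  2≤Y+2 : 2 ≤ r ^ 2 + 2
  2≤Y+2 = m≤n+m 2 (r ^ 2)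

  cases : S (r ^ 2 + 2) ⊎ S (suc (r ^ 2 + 2)) → S (r ^ 2 ∸ 2) ⊎ S (suc (r ^ 2 ∸ 2)) →
          SquareRatioPair S (4 * k)
  cases (inj₁ sY+2) _ = ratioPair (r ^ 2 + 2) r 2≤Y+2 2≤r k≤Y+2 sY+2
                          (subst S (*-comm (r ^ 2) (r ^ 2 + 2)) s₊)
  cases (inj₂ _) (inj₁ sY∸2) = ratioPair (r ^ 2 ∸ 2) r 2≤Y∸2 2≤r k≤Y∸2 sY∸2
                                 (subst S (*-comm (r ^ 2) (r ^ 2 ∸ 2)) s₋)
  cases (inj₂ sY+3) (inj₂ sY∸1) = fourMultiplesPair T k 2≤k
                                    (subst S (successorBelow 1≤k sq) sY∸1)
                                    (subst S (successorAbove sq) sY+3)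

oddSquare : ∀ n → (2 * n + 1) ^ 2 ≡ 1 + 4 * (n * (1 + n))
oddSquare n = expand n
  where
  -- x ^ 2 unfolds to x * (x * 1), which the ring solver normalises.
  expand : ∀ n → (2 * n + 1) * ((2 * n + 1) * 1) ≡ 1 + 4 * (n * (1 + n))
  expand = solve-∀

lemma4p2 : (n : ℕ) → 1 ≤ n → (S : ℕ → Set) → TwoSyndetic S →
           let y = 2 * n + 1 in
           S (y ^ 2 * (y ^ 2 + 2)) → S (y ^ 2 * (y ^ 2 ∸ 2)) →
           ∃[ x ] ∃[ r ] (2 ≤ x × 2 ≤ r × S x × S (x * r ^ 2) × y ^ 2 ∸ 1 ≤ 4 * x)
lemma4p2 (suc m) _ S T s₊ s₋ =
  subst (SquareRatioPair S) (sym (cong (_∸ 1) y²≡4k+1))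
    (nearSquarePair T y k 2≤y 2≤k y²≡4k+1 s₊ s₋)
  where
  y k : ℕ
  y = 2 * suc m + 1
  k = suc m * suc (suc m)

  y²≡4k+1 : y ^ 2 ≡ suc (4 * k)
  y²≡4k+1 = oddSquare (suc m)

  2≤y : 2 ≤ y
  2≤y = s≤s (m≤n+m 1 _)

  2≤k : 2 ≤ k
  2≤k = s≤s (s≤s z≤n)
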